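{- Let $m,n\in\mathbb{N}$, $n>1$, $m=\omega(n)$. Let $(\pi_2,\dots,\pi_n)$ be a permutation of $\{p_2,\dots,p_n\}$ and $q_2,\dots,q_n\in\{1,\dots,m\}$ such that: $q_i\not\equiv 0\pmod{\pi_i}$ for $i=2,\dots,n$; $i<j\Rightarrow q_i<q_j$; $q_2=1$; $q_i=\min\{j\in\{1,\dots,m\}\mid\forall k<i: j\not\equiv q_k\pmod{\pi_k}\}$ for $i=3,\dots,n$; and for every $q\in\{1,\dots,m\}$ there is $i\in\{2,\dots,n\}$ with $q\equiv q_i\pmod{\pi_i}$. Suppose there exist $k_1,k_2\in\{2,\dots,n\}$ with $k_1<k_2$ and $q_{k_1}\equiv q_{k_2}\pmod{\pi_{k_2}}$. Then there exist a permutation $(\varrho_2,\dots,\varrho_n)$ of $\{p_2,\dots,p_n\}$ and $r_2,\dots,r_n\in\{1,\dots,m\}$ such that: $r_i\not\equiv 0\pmod{\varrho_i}$ for $i=2,\dots,n$; $i<j\Rightarrow r_i<r_j$; $r_2=1$; $r_i=\min\{j\in\{1,\dots,m\}\mid\forall k<i: j\not\equiv r_k\pmod{\varrho_k}\}$ for $i=3,\dots,n$; for every $q\in\{1,\dots,m\}$ there is $i\in\{2,\dots,n\}$ with $q\equiv r_i\pmod{\varrho_i}$; and moreover $\varrho_k=\pi_k$ and $r_k=q_k$ for all $k\in\{2,\dots,n\}$ with $k<k_1$, $\varrho_{k_1}=\pi_{k_2}$ and $r_{k_1}=q_{k_1}$, and for all $k\in\{2,\dots,n\}$ with $k>k_1$: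 $r_k\equiv q_j\pmod{\varrho_k}$ whenever $\varrho_k=\pi_j$.
   Context: Let $p_1=2,p_2=3,p_3=5,\dots$ be the primes in increasing order. For $n>1$, $\omega(n)$ denotes the greatest length of a sequence of consecutive integers each of which is divisible by at least one of the primes $p_2,\dots,p_n$. -}

module Defs where

open import Data.Nat using (ℕ; zero; suc; _+_; _≤_; _<_; _!; ∣_-_∣)
open import Data.Nat.Divisibility using (_∣_)
open import Data.Nat.Primality using (prime?)
open import Data.Bool using (if_then_else_)
open import Data.Product using (Σ; ∃; _×_)
open import Relation.Nullary using (¬_; does)
open import Relation.Binary.PropositionalEquality using (_≡_)
import Data.Integer as ℤ
import Data.Integer.Divisibility as ℤD

nextPrimeFrom : ℕ → ℕ → ℕ
nextPrimeFrom zero    c = c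
nextPrimeFrom (suc f) c = if does (prime? c) then c else nextPrimeFrom f (suc c)

-- Least prime > x  (a prime exists in (x, x! + 1], so fuel x! suffices).
nextPrime : ℕ → ℕ
nextPrime x = nextPrimeFrom (x !) (suc x)

-- p i = i-th prime (p 1 = 2, p 2 = 3, ...); p 0 is a dummy value, never used.
p : ℕ → ℕ
p zero          = 0
p (suc zero)    = 2
p (suc (suc k)) = nextPrime (p (suc k))

Cong : ℕ → ℕ → ℕ → Set
Cong a b d = d ∣ ∣ a - b ∣

CoveredRun : ℕ → ℤ.ℤ → ℕ → Set
CoveredRun n a len =
  ∀ t → t < len → ∃ λ j → 2 ≤ j × j ≤ n × (ℤ.+ (p j)) ℤD.∣ (a ℤ.+ ℤ.+ t)

IsOmega : ℕ → ℕ → Set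
IsOmega n m = (∃ λ a → CoveredRun n a m) × (∀ a len → CoveredRun n a len → len ≤ m)

Avoids : (π q : ℕ → ℕ) → ℕ → ℕ → Set
Avoids π q i j = ∀ k → 2 ≤ k → k < i → ¬ Cong j (q k) (π k)

IsMinAvoid : ℕ → (π q : ℕ → ℕ) → ℕ → ℕ → Set
IsMinAvoid m π q i x =
  (1 ≤ x × x ≤ m × Avoids π q i x) ×
  (∀ j → 1 ≤ j → j ≤ m → Avoids π q i j → x ≤ j)

IsPermPrimes : ℕ → (ℕ → ℕ) → Set
IsPermPrimes n π =
  (∀ i → 2 ≤ i → i ≤ n → ∃ λ j → 2 ≤ j × j ≤ n × π i ≡ p j) ×
  (∀ i i′ → 2 ≤ i → i ≤ n → 2 ≤ i′ → i′ ≤ n → π i ≡ π i′ → i ≡ i′) ×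
  (∀ j → 2 ≤ j → j ≤ n → ∃ λ i → 2 ≤ i × i ≤ n × π i ≡ p j)

Admissible : ℕ → ℕ → (π q : ℕ → ℕ) → Set
Admissible n m π q =
  IsPermPrimes n π ×
  (∀ i → 2 ≤ i → i ≤ n → 1 ≤ q i × q i ≤ m) ×
  (∀ i → 2 ≤ i → i ≤ n → ¬ Cong (q i) 0 (π i)) ×
  (∀ i j → 2 ≤ i → i < j → j ≤ n → q i < q j) ×
  (q 2 ≡ 1) ×
  (∀ i → 3 ≤ i → i ≤ n → IsMinAvoid m π q i (q i)) ×
  (∀ x → 1 ≤ x → x ≤ m → ∃ λ i → 2 ≤ i × i ≤ n × Cong x (q i) (π i))

module Submission where

-- The new pair (ϱ, r) is produced by rerunning the greedy construction with the roles of
-- π k₁ and π k₂ exchanged.  Positions k < k₁ copy (π k, q k) and position k₁ takes π k₂ with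
-- residue q k₁.  At each later position k, r k is the least x ∈ [1, m] not yet covered, and
-- ϱ k = π j for an index j with r k ≡ q j (mod π j); such j exists since the classes q j mod π j
-- cover [1, m], and it is still unused because r k is uncovered.  Throughout, r k ≡ q j (mod π j)
-- whenever ϱ k = π j, so being covered by the new classes before k is the same as being covered
-- by the old classes of the indices used before k, which gives all the required properties.
-- The construction cannot get stuck: if the classes of fewer than n - 1 indices covered [1, m],
-- the Chinese remainder theorem would add the class of an unused prime and produce a covered
-- run of length m + 1 > ω(n).

open import Defs
open import Data.Nat.Base
open import Data.Nat.Properties
open import Data.Nat.Divisibility using (_∣_; _∣?_; _∣0; ∣-trans; m∣m*n; ∣1⇒≡1; ∣m+n∣m⇒∣n; m≤n⇒m!∣n!; ∣⇒≤)
open import Data.Nat.Primality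
open import Data.Nat.Primality.Factorisation using (factorise; factorisationHasAllPrimeFactors)
open import Data.Nat.Coprimality using (Coprime; coprime-Bézout)
open import Data.Nat.GCD using (module Bézout)
open import Data.Nat.ListAction using (product)
open import Data.Nat.ListAction.Properties using (∈⇒∣product)
open import Data.List.Base using (List; []; _∷_; map; length; lookup; applyUpTo; filter)
open import Data.List.Properties using (length-applyUpTo; filter-notAll)
open import Data.List.Relation.Unary.All using (All; []; _∷_)
import Data.List.Relation.Unary.All as All
import Data.List.Relation.Unary.All.Properties as All
open import Data.List.Relation.Unary.AllPairs using ([]; _∷_)
open import Data.List.Relation.Unary.Unique.Propositional using (Unique)
open import Data.List.Membership.Propositional using (_∈_; _∉_; find; lose)
open import Data.List.Membership.Propositional.Properties using (∈-map⁺; ∈-lookup; ∈-applyUpTo⁺; ∈-applyUpTo⁻; ∈-filter⁺)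
open import Data.List.Membership.DecPropositional _≟_ using (_∈?_; _∉?_)
import Data.List.Relation.Unary.AllPairs.Properties as AllPairs
import Data.List.Relation.Unary.Unique.Propositional.Properties as Unique
open import Data.List.Relation.Binary.Subset.Propositional using (_⊆_)
open import Data.List.Relation.Unary.Any using (Any; here; there; any?)
import Data.List.Relation.Unary.Any as Any
open import Data.List.Relation.Unary.Any.Properties using (lookup-index)
open import Data.Fin.Base using (Fin; zero; suc)
open import Data.Fin.Properties using (injective⇒≤)
open import Function.Definitions using (Injective)
open import Relation.Unary using (Decidable)
open import Data.Product using (∃; _×_; _,_; proj₁; proj₂)
open import Data.Sum using (inj₁; inj₂; [_,_]′)
open import Function using (_∘_)
open import Relation.Nullary using (¬_; Dec; yes; no; contradiction)
open import Relation.Nullary.Decidable using (_×-dec_; ¬?; decidable-stable)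
open import Relation.Binary.Definitions using (tri<; tri≈; tri>)
open import Relation.Binary.PropositionalEquality
import Data.Integer as ℤ
open ℤ using (ℤ; +_)
import Data.Integer.Properties as ℤ
import Data.Integer.Divisibility as ℤD
open import Data.Integer.Divisibility.Signed as ℤ∣
  using (∣ᵤ⇒∣; ∣⇒∣ᵤ; divides; ∣m∣n⇒∣m+n; ∣m∣n⇒∣m-n; ∣n⇒∣m*n)
  renaming (_∣_ to _∣ℤ_)
open import Data.Integer.Solver using (module +-*-Solver)
open +-*-Solver using (solve; _:+_; _:-_; _:*_; :-_; _:=_; con)

nextPrimeFrom-prime : ∀ f c {q} → Prime q → c ≤ q → q ≤ c + f → Prime (nextPrimeFrom f c)
nextPrimeFrom-prime zero c pq c≤q q≤c+0 =
  subst Prime (≤-antisym (subst (_ ≤_) (+-identityʳ c) q≤c+0) c≤q) pq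
nextPrimeFrom-prime (suc f) c {q} pq c≤q q≤c+1+f with prime? c
... | yes pc = pc
... | no ¬pc = nextPrimeFrom-prime f (suc c) pq
  (≤∧≢⇒< c≤q λ { refl → ¬pc pq }) (subst (q ≤_) (+-suc c f) q≤c+1+f)

prime-divisor : ∀ {n} → 2 ≤ n → ∃ λ q → Prime q × q ∣ n
prime-divisor {n} 2≤n with factorise n {{>-nonZero (<-trans z<s 2≤n)}}
... | record { factors = [] ; isFactorisation = eq } = contradiction eq (≢-sym (<⇒≢ 2≤n))
... | record { factors = q ∷ qs ; isFactorisation = eq ; factorsPrime = pq ∷ _ } =
  q , pq , subst (q ∣_) (sym eq) (m∣m*n (product qs))

m∣n! : ∀ {m n} → 1 ≤ m → m ≤ n → m ∣ n !
m∣n! {suc m} _ 1+m≤n = ∣-trans (m∣m*n (m !)) (m≤n⇒m!∣n! 1+m≤n)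

-- Euclid: a prime factor of x ! + 1 exceeds x.
prime-above : ∀ x → ∃ λ q → Prime q × x < q × q ≤ suc (x !)
prime-above x with prime-divisor (s≤s (1≤n! x))
... | q , pq , q∣1+x! = q , pq , x<q , ∣⇒≤ q∣1+x!
  where
  instance
    q-nonTrivial : NonTrivial q
    q-nonTrivial = prime⇒nonTrivial pq
  x<q : x < q
  x<q with x <? q
  ... | yes x<q = x<q
  ... | no x≮q = contradiction
    (∣1⇒≡1 (∣m+n∣m⇒∣n (subst (q ∣_) (+-comm 1 (x !)) q∣1+x!) (m∣n! (<⇒≤ (nonTrivial⇒n>1 q)) (≮⇒≥ x≮q))))
    nonTrivial⇒≢1

nextPrime-prime : ∀ x → Prime (nextPrime x)
nextPrime-prime x with prime-above x
... | q , pq , x<q , q≤1+x! = nextPrimeFrom-prime (x !) (suc x) pq x<q (≤-trans q≤1+x! (+-monoˡ-≤ (x !) (s≤s z≤n)))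

p-prime : ∀ {j} → 1 ≤ j → Prime (p j)
p-prime {suc zero}    _ = prime[2]
p-prime {suc (suc j)} _ = nextPrime-prime (p (suc j))

∣+m-+n∣≡∣m-n∣ : ∀ m n → ℤ.∣ + m ℤ.- + n ∣ ≡ ∣ m - n ∣
∣+m-+n∣≡∣m-n∣ m n rewrite ℤ.m-n≡m⊖n m n with ≤-total m n
... | inj₁ m≤n = trans (ℤ.∣⊖∣-≤ m≤n) (sym (m≤n⇒∣m-n∣≡n∸m m≤n))
... | inj₂ n≤m = trans (ℤ.∣m⊖n∣≡∣n⊖m∣ m n) (trans (ℤ.∣⊖∣-≤ n≤m) (sym (m≤n⇒∣n-m∣≡n∸m n≤m)))

Cong⇒∣ : ∀ a b {d} → Cong a b d → + d ∣ℤ + a ℤ.- + b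
Cong⇒∣ a b {d} a≡b = ∣ᵤ⇒∣ (subst (d ∣_) (sym (∣+m-+n∣≡∣m-n∣ a b)) a≡b)

∣⇒Cong : ∀ a b {d} → + d ∣ℤ + a ℤ.- + b → Cong a b d
∣⇒Cong a b {d} d∣a-b = subst (d ∣_) (∣+m-+n∣≡∣m-n∣ a b) (∣⇒∣ᵤ d∣a-b)

Cong? : ∀ a b d → Dec (Cong a b d)
Cong? a b d = d ∣? ∣ a - b ∣

Cong-refl : ∀ a {d} → Cong a a d
Cong-refl a {d} = subst (d ∣_) (sym (∣n-n∣≡0 a)) (d ∣0)

Cong-sym : ∀ a b {d} → Cong a b d → Cong b a d
Cong-sym a b {d} = subst (d ∣_) (∣-∣-comm a b)

Cong-trans : ∀ a b c {d} → Cong a b d → Cong b c d → Cong a c d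
Cong-trans a b c a≡b b≡c =
  ∣⇒Cong a c (subst (_ ∣ℤ_) telescope (∣m∣n⇒∣m+n (Cong⇒∣ a b a≡b) (Cong⇒∣ b c b≡c)))
  where
  telescope : (+ a ℤ.- + b) ℤ.+ (+ b ℤ.- + c) ≡ + a ℤ.- + c
  telescope = solve 3 (λ x y z → (x :- y) :+ (y :- z) := x :- z) refl (+ a) (+ b) (+ c)

prime∤⇒coprime : ∀ {q n} → Prime q → ¬ q ∣ n → Coprime q n
prime∤⇒coprime pq q∤n (d∣q , d∣n) with prime⇒irreducible pq d∣q
... | inj₁ d≡1 = d≡1
... | inj₂ refl = contradiction d∣n q∤n

pos-1+m*n : ∀ m n → + (1 + m * n) ≡ + 1 ℤ.+ + m ℤ.* + n
pos-1+m*n m n = cong (ℤ._+_ (+ 1)) (ℤ.pos-* m n)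

coprime⇒idempotent : ∀ {q m} → Coprime q m → ∃ λ e → + m ∣ℤ e × + q ∣ℤ + 1 ℤ.- e
coprime⇒idempotent {q} {m} q⊥m with coprime-Bézout q⊥m
... | Bézout.+- x y 1+ym≡xq =
  ℤ.- (+ y ℤ.* + m) , divides (ℤ.- + y) (ℤ.neg-distribˡ-* (+ y) (+ m)) ,
  divides (+ x) (begin
    + 1 ℤ.- ℤ.- (+ y ℤ.* + m)  ≡⟨ cong (ℤ._+_ (+ 1)) (ℤ.neg-involutive (+ y ℤ.* + m)) ⟩
    + 1 ℤ.+ + y ℤ.* + m        ≡⟨ pos-1+m*n y m ⟨
    + (1 + y * m)              ≡⟨ cong +_ 1+ym≡xq ⟩
    + (x * q)                  ≡⟨ ℤ.pos-* x q ⟩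
    + x ℤ.* + q                ∎)
  where open ≡-Reasoning
... | Bézout.-+ x y 1+xq≡ym =
  + y ℤ.* + m , divides (+ y) refl ,
  divides (ℤ.- + x) (begin
    + 1 ℤ.- + y ℤ.* + m                  ≡⟨ cong (λ z → + 1 ℤ.- z) (ℤ.pos-* y m) ⟨
    + 1 ℤ.- + (y * m)                    ≡⟨ cong (λ z → + 1 ℤ.- + z) 1+xq≡ym ⟨
    + 1 ℤ.- + (1 + x * q)                ≡⟨ cong (λ z → + 1 ℤ.- z) (pos-1+m*n x q) ⟩
    + 1 ℤ.- (+ 1 ℤ.+ + x ℤ.* + q)        ≡⟨ solve 2 (λ x q → con (+ 1) :- (con (+ 1) :+ x :* q) := (:- x) :* q) refl (+ x) (+ q) ⟩
    ℤ.- + x ℤ.* + q                      ∎)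
  where open ≡-Reasoning

crt : (μ : ℕ → ℕ) (s : ℕ → ℤ) (is : List ℕ) → All (Prime ∘ μ) is → Unique (map μ is) →
      ∃ λ a → All (λ i → + μ i ∣ℤ s i ℤ.- a) is
crt μ s []       _          _          = + 0 , []
crt μ s (i ∷ is) (pᵢ ∷ ps) (μᵢ∉ ∷ u) with crt μ s is ps u | coprime⇒idempotent (prime∤⇒coprime pᵢ μᵢ∤M)
  where
  μᵢ∤M : ¬ μ i ∣ product (map μ is)
  μᵢ∤M μᵢ∣M = All.lookup μᵢ∉ (factorisationHasAllPrimeFactors pᵢ μᵢ∣M (All.map⁺ ps)) refl
... | a , ha | e , M∣e , μᵢ∣1-e = b , μᵢ∣sᵢ-b ∷ All.tabulate μⱼ∣sⱼ-b
  where
  b = a ℤ.+ (s i ℤ.- a) ℤ.* e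
  μᵢ∣sᵢ-b : + μ i ∣ℤ s i ℤ.- b
  μᵢ∣sᵢ-b = subst (_ ∣ℤ_) (solve 3 (λ sᵢ a e → (sᵢ :- a) :* (con (+ 1) :- e) := sᵢ :- (a :+ (sᵢ :- a) :* e)) refl (s i) a e)
                  (∣n⇒∣m*n (s i ℤ.- a) μᵢ∣1-e)
  μⱼ∣sⱼ-b : ∀ {j} → j ∈ is → + μ j ∣ℤ s j ℤ.- b
  μⱼ∣sⱼ-b {j} j∈is = subst (_ ∣ℤ_) (solve 4 (λ sⱼ a sᵢ e → (sⱼ :- a) :- (sᵢ :- a) :* e := sⱼ :- (a :+ (sᵢ :- a) :* e)) refl (s j) a (s i) e)
    (∣m∣n⇒∣m-n (All.lookup ha j∈is) (∣n⇒∣m*n (s i ℤ.- a) (ℤ∣.∣-trans (∣ᵤ⇒∣ (∈⇒∣product (∈-map⁺ μ j∈is))) M∣e)))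

lookup-injective : ∀ {a} {A : Set a} {xs : List A} → Unique xs → ∀ {i j} → lookup xs i ≡ lookup xs j → i ≡ j
lookup-injective {xs = _ ∷ _} (x∉ ∷ u) {zero}  {zero}  _  = refl
lookup-injective {xs = _ ∷ _} (x∉ ∷ u) {zero}  {suc j} eq = contradiction eq (All.lookup x∉ (∈-lookup j))
lookup-injective {xs = _ ∷ _} (x∉ ∷ u) {suc i} {zero}  eq = contradiction (sym eq) (All.lookup x∉ (∈-lookup i))
lookup-injective {xs = _ ∷ _} (x∉ ∷ u) {suc i} {suc j} eq = cong suc (lookup-injective u eq)

-- Pigeonhole: the position in ys of each entry of xs is an injection Fin (length xs) → Fin (length ys).
unique⊆⇒length≤ : ∀ {a} {A : Set a} {xs ys : List A} → Unique xs → xs ⊆ ys → length xs ≤ length ys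
unique⊆⇒length≤ {xs = xs} {ys} u xs⊆ys = injective⇒≤ position-injective
  where
  position : Fin (length xs) → Fin (length ys)
  position i = Any.index (xs⊆ys (∈-lookup i))
  position-injective : Injective _≡_ _≡_ position
  position-injective {i} {j} eq = lookup-injective u (begin
    lookup xs i             ≡⟨ lookup-index (xs⊆ys (∈-lookup i)) ⟩
    lookup ys (position i)  ≡⟨ cong (lookup ys) eq ⟩
    lookup ys (position j)  ≡⟨ lookup-index (xs⊆ys (∈-lookup j)) ⟨
    lookup xs j             ∎)
    where open ≡-Reasoning

module _ {p} {P : ℕ → Set p} (P? : Decidable P) where

  -- v when no x < v satisfies P
  least : ℕ → ℕ
  least zero    = zero
  least (suc v) with anyUpTo? P? v
  ... | yes _ = least v
  ... | no  _ = v

  least-spec : ∀ {v x} → x < v → P x → P (least v) × least v ≤ x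
  least-spec {suc v} {x} x<1+v px with anyUpTo? P? v | x <? v
  ... | yes _              | yes x<v = least-spec x<v px
  ... | yes (y , y<v , py) | no x≮v  =
    proj₁ (least-spec y<v py) , ≤-trans (proj₂ (least-spec y<v py)) (≤-trans (<⇒≤ y<v) (≮⇒≥ x≮v))
  ... | no ∄               | yes x<v = contradiction (x , x<v , px) ∄
  ... | no _               | no x≮v  = subst P (≤-antisym (≤-pred x<1+v) (≮⇒≥ x≮v)) px , ≮⇒≥ x≮v

module _ {a p} {A : Set a} {P : A → Set p} (P? : Decidable P) where

  pick : A → List A → A
  pick d xs with any? P? xs
  ... | yes ∃P = proj₁ (find ∃P)
  ... | no  _  = d

  pick-spec : ∀ {d xs} → Any P xs → pick d xs ∈ xs × P (pick d xs)
  pick-spec {d} {xs} ∃P with any? P? xs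
  ... | yes ∃P′ = proj₂ (find ∃P′)
  ... | no  ∄P  = contradiction ∃P ∄P

indices : ℕ → List ℕ
indices n = applyUpTo (_+_ 2) (n ∸ 1)

∈-indices⁺ : ∀ {n j} → 2 ≤ j → j ≤ n → j ∈ indices n
∈-indices⁺ {suc n} {suc (suc i)} (s≤s (s≤s z≤n)) (s≤s i<n) = ∈-applyUpTo⁺ (_+_ 2) i<n

∈-indices⁻ : ∀ {n j} → j ∈ indices n → 2 ≤ j × j ≤ n
∈-indices⁻ {suc n} j∈ with ∈-applyUpTo⁻ (_+_ 2) j∈
... | i , i<n , refl = s≤s (s≤s z≤n) , s≤s i<n

indices-unique : ∀ n → Unique (indices n)
indices-unique n = Unique.applyUpTo⁺₁ (_+_ 2) (n ∸ 1) (λ i<j _ → <⇒≢ (s≤s (s≤s i<j)))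

length-indices : ∀ n → length (indices n) ≡ n ∸ 1
length-indices n = length-applyUpTo (_+_ 2) (n ∸ 1)

k∸2<n∸1 : ∀ {k n} → 2 ≤ k → k ≤ n → k ∸ 2 < n ∸ 1
k∸2<n∸1 {suc (suc _)} {suc _} _         (s≤s k<n) = k<n
k∸2<n∸1 {suc zero}            (s≤s ()) _

permPrimes-prime : ∀ {n π} → IsPermPrimes n π → ∀ {i} → 2 ≤ i → i ≤ n → Prime (π i)
permPrimes-prime (onto-primes , _ , _) 2≤i i≤n with onto-primes _ 2≤i i≤n
... | j , 2≤j , _ , πᵢ≡pⱼ = subst Prime (sym πᵢ≡pⱼ) (p-prime (<⇒≤ 2≤j))

permPrimes-distinct : ∀ {n π} → IsPermPrimes n π → Unique (map π (indices n))
permPrimes-distinct {n} {π} (_ , injective , _) = AllPairs.map⁺ (AllPairs.applyUpTo⁺₁ (_+_ 2) (n ∸ 1) π-distinct)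
  where
  π-distinct : ∀ {i j} → i < j → j < n ∸ 1 → π (2 + i) ≢ π (2 + j)
  π-distinct {i} {j} i<j j<n πᵢ≡πⱼ = <⇒≢ i<j (cong (_∸ 2) (injective (2 + i) (2 + j)
    (s≤s (s≤s z≤n)) (proj₂ (∈-indices⁻ (∈-applyUpTo⁺ (_+_ 2) (<-trans i<j j<n))))
    (s≤s (s≤s z≤n)) (proj₂ (∈-indices⁻ (∈-applyUpTo⁺ (_+_ 2) j<n))) πᵢ≡πⱼ))

module Covering (π q : ℕ → ℕ) where

  Covered : List ℕ → ℕ → Set
  Covered U x = Any (λ i → Cong x (q i) (π i)) U

  covered? : ∀ U x → Dec (Covered U x)
  covered? U x = any? (λ i → Cong? x (q i) (π i)) U

  Uncovered : List ℕ → ℕ → Set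
  Uncovered U x = 1 ≤ x × ¬ Covered U x

  uncovered? : ∀ U → Decidable (Uncovered U)
  uncovered? U x = (1 ≤? x) ×-dec ¬? (covered? U x)

  covered-run : ∀ {n m U j} → IsPermPrimes n π → U ⊆ indices n → (∀ x → 1 ≤ x → x ≤ m → Covered U x) →
                j ∈ indices n → ∀ b → (∀ {i} → i ∈ U → + π i ∣ℤ + q i ℤ.- b) → + π j ∣ℤ + suc m ℤ.- b →
                CoveredRun n (+ 1 ℤ.- b) (suc m)
  covered-run {n} {m} {U} {j} (onto-primes , _) U⊆indices covering j∈indices b π∣q-b π∣1+m-b t t<1+m
    with π∣x-b (suc t) (s≤s z≤n) t<1+m
    where
    π∣x-b : ∀ x → 1 ≤ x → x ≤ suc m → ∃ λ i → i ∈ indices n × + π i ∣ℤ + x ℤ.- b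
    π∣x-b x 1≤x x≤1+m with m <? x
    ... | yes m<x rewrite ≤-antisym x≤1+m m<x = j , j∈indices , π∣1+m-b
    ... | no  m≮x with find (covering x 1≤x (≮⇒≥ m≮x))
    ...   | i , i∈U , x≡qᵢ = i , U⊆indices i∈U ,
      subst (_ ∣ℤ_) (solve 3 (λ x y z → (x :- y) :+ (y :- z) := x :- z) refl (+ x) (+ q i) b)
        (∣m∣n⇒∣m+n (Cong⇒∣ x (q i) x≡qᵢ) (π∣q-b i∈U))
  ... | i , i∈ , πᵢ∣1+t-b with onto-primes i (proj₁ (∈-indices⁻ {n} i∈)) (proj₂ (∈-indices⁻ {n} i∈))
  ...   | i′ , 2≤i′ , i′≤n , πᵢ≡pᵢ′ = i′ , 2≤i′ , i′≤n ,
    subst₂ (λ d z → + d ℤD.∣ z) πᵢ≡pᵢ′ (solve 2 (λ t b → (con (+ 1) :+ t) :- b := (con (+ 1) :- b) :+ t) refl (+ t) b)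
      (∣⇒∣ᵤ πᵢ∣1+t-b)

  -- If an index j ∉ U, CRT gives b ≡ q i (mod π i) for i ≠ j and b ≡ m + 1 (mod π j), and
  -- covered-run turns this into a covered run of length m + 1 > ω(n).
  covering⇒complete : ∀ {n m U} → IsOmega n m → IsPermPrimes n π → U ⊆ indices n →
                      (∀ x → 1 ≤ x → x ≤ m → Covered U x) → indices n ⊆ U
  covering⇒complete {n} {m} {U} (_ , maximal) perm U⊆indices covering {j} j∈indices with j ∈? U
  ... | yes j∈U = j∈U
  ... | no  j∉U = contradiction
    (maximal (+ 1 ℤ.- b) (suc m) (covered-run perm U⊆indices covering j∈indices b π∣q-b π∣1+m-b)) (n≮n m)
    where
    target : ℕ → ℕ
    target i with i ≟ j
    ... | yes _ = suc m
    ... | no  _ = q i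

    target-j : target j ≡ suc m
    target-j with j ≟ j
    ... | yes _  = refl
    ... | no j≢j = contradiction refl j≢j

    target-i : ∀ {i} → i ≢ j → target i ≡ q i
    target-i {i} i≢j with i ≟ j
    ... | yes i≡j = contradiction i≡j i≢j
    ... | no  _   = refl

    solution : ∃ λ b → All (λ i → + π i ∣ℤ + target i ℤ.- b) (indices n)
    solution = crt π (+_ ∘ target) (indices n)
      (All.tabulate λ i∈ → permPrimes-prime perm (proj₁ (∈-indices⁻ {n} i∈)) (proj₂ (∈-indices⁻ {n} i∈)))
      (permPrimes-distinct perm)

    b : ℤ
    b = proj₁ solution

    π∣q-b : ∀ {i} → i ∈ U → + π i ∣ℤ + q i ℤ.- b
    π∣q-b i∈U = subst (λ y → _ ∣ℤ + y ℤ.- b) (target-i λ { refl → j∉U i∈U }) (All.lookup (proj₂ solution) (U⊆indices i∈U))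

    π∣1+m-b : + π j ∣ℤ + suc m ℤ.- b
    π∣1+m-b = subst (λ y → _ ∣ℤ + y ℤ.- b) target-j (All.lookup (proj₂ solution) j∈indices)

module Exchange (n m : ℕ) (π q : ℕ → ℕ) (k₁ k₂ : ℕ) where

  open Covering π q

  IsLeastUncovered : List ℕ → ℕ → Set
  IsLeastUncovered U l =
    (1 ≤ l × l ≤ m × ¬ Covered U l) × (∀ x → 1 ≤ x → x ≤ m → ¬ Covered U x → l ≤ x)

  leastUncovered : List ℕ → ℕ
  leastUncovered U = least (uncovered? U) (suc m)

  leastUncovered-spec : ∀ {U x} → 1 ≤ x → x ≤ m → ¬ Covered U x → IsLeastUncovered U (leastUncovered U)
  leastUncovered-spec {U} 1≤x x≤m x∉U with least-spec (uncovered? U) (s≤s x≤m) (1≤x , x∉U)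
  ... | (1≤l , l∉U) , l≤x = (1≤l , ≤-trans l≤x x≤m , l∉U) ,
    λ z 1≤z z≤m z∉U → proj₂ (least-spec (uncovered? U) (s≤s z≤m) (1≤z , z∉U))

  -- The index placed at position k, given the indices U already placed at positions 2, ..., k - 1.
  choice : ℕ → List ℕ → ℕ
  choice k U with <-cmp k k₁
  ... | tri< _ _ _ = k
  ... | tri≈ _ _ _ = k₂
  ... | tri> _ _ _ = pick (λ j → (j ∉? U) ×-dec Cong? (leastUncovered U) (q j) (π j)) 0 (indices n)

  usedBefore : ℕ → List ℕ
  usedBefore (suc k@(suc (suc _))) = choice k (usedBefore k) ∷ usedBefore k
  usedBefore _                     = []

  chosen : ℕ → ℕ
  chosen k = choice k (usedBefore k)

  ϱ r : ℕ → ℕ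
  ϱ k = π (chosen k)
  r k = leastUncovered (usedBefore k)

  choice-before : ∀ {k U} → k < k₁ → choice k U ≡ k
  choice-before {k} k<k₁ with <-cmp k k₁
  ... | tri< _ _ _    = refl
  ... | tri≈ k≮k₁ _ _ = contradiction k<k₁ k≮k₁
  ... | tri> k≮k₁ _ _ = contradiction k<k₁ k≮k₁

  choice-at : ∀ {U} → choice k₁ U ≡ k₂
  choice-at with <-cmp k₁ k₁
  ... | tri< _ k≢k _ = contradiction refl k≢k
  ... | tri≈ _ _ _   = refl
  ... | tri> _ k≢k _ = contradiction refl k≢k

  ∈-usedBefore⁺ : ∀ {i k} → 2 ≤ i → i < k → chosen i ∈ usedBefore k
  ∈-usedBefore⁺ {k = suc (suc (suc k))} 2≤i (s≤s i≤2+k) =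
    [ (λ i<2+k → there (∈-usedBefore⁺ {k = suc (suc k)} 2≤i i<2+k)) , (λ { refl → here refl }) ]′ (m≤n⇒m<n∨m≡n i≤2+k)
  ∈-usedBefore⁺ {k = suc zero}       (s≤s (s≤s _)) (s≤s ())
  ∈-usedBefore⁺ {k = suc (suc zero)} (s≤s (s≤s _)) (s≤s (s≤s ()))

  ∈-usedBefore⁻ : ∀ {j k} → j ∈ usedBefore k → ∃ λ i → 2 ≤ i × i < k × chosen i ≡ j
  ∈-usedBefore⁻ {k = suc k@(suc (suc _))} (here refl) = k , s≤s (s≤s z≤n) , ≤-refl , refl
  ∈-usedBefore⁻ {k = suc k@(suc (suc _))} (there j∈) with ∈-usedBefore⁻ {k = k} j∈
  ... | i , 2≤i , i<k , chosenᵢ≡j = i , 2≤i , m≤n⇒m≤1+n i<k , chosenᵢ≡j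

  length-usedBefore : ∀ k → length (usedBefore k) ≡ k ∸ 2
  length-usedBefore (suc k@(suc (suc _))) = cong suc (length-usedBefore k)
  length-usedBefore zero                  = refl
  length-usedBefore (suc zero)            = refl
  length-usedBefore (suc (suc zero))      = refl

  covered⁺ : ∀ {i k x} → 2 ≤ i → i < k → Cong x (q (chosen i)) (ϱ i) → Covered (usedBefore k) x
  covered⁺ 2≤i i<k x≡ = lose (∈-usedBefore⁺ 2≤i i<k) x≡

  covered⁻ : ∀ {k x} → Covered (usedBefore k) x → ∃ λ i → 2 ≤ i × i < k × Cong x (q (chosen i)) (ϱ i)
  covered⁻ x∈ with find x∈
  ... | j , j∈ , x≡ with ∈-usedBefore⁻ j∈
  ... | i , 2≤i , i<k , refl = i , 2≤i , i<k , x≡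

  module Properties
    (ω : IsOmega n m) (perm : IsPermPrimes n π)
    (q-range : ∀ i → 2 ≤ i → i ≤ n → 1 ≤ q i × q i ≤ m)
    (q-nonzero : ∀ i → 2 ≤ i → i ≤ n → ¬ Cong (q i) 0 (π i))
    (q₂≡1 : q 2 ≡ 1)
    (q-minAvoid : ∀ i → 3 ≤ i → i ≤ n → IsMinAvoid m π q i (q i))
    (q-covers : ∀ x → 1 ≤ x → x ≤ m → ∃ λ i → 2 ≤ i × i ≤ n × Cong x (q i) (π i))
    (2≤k₁ : 2 ≤ k₁) (k₁<k₂ : k₁ < k₂) (k₂≤n : k₂ ≤ n) (q₁≡q₂ : Cong (q k₁) (q k₂) (π k₂))
    where

    ∈-usedBefore-early : ∀ {j k} → k ≤ k₁ → j ∈ usedBefore k → 2 ≤ j × j < k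
    ∈-usedBefore-early {k = k} k≤k₁ j∈ with ∈-usedBefore⁻ j∈
    ... | i , 2≤i , i<k , refl =
      subst (λ j → 2 ≤ j × j < k) (sym (choice-before (<-≤-trans i<k k≤k₁))) (2≤i , i<k)

    avoids⇒uncovered-early : ∀ {k x} → k ≤ k₁ → Avoids π q k x → ¬ Covered (usedBefore k) x
    avoids⇒uncovered-early k≤k₁ avoids x∈ with find x∈
    ... | j , j∈ , x≡qⱼ = avoids j (proj₁ (∈-usedBefore-early k≤k₁ j∈)) (proj₂ (∈-usedBefore-early k≤k₁ j∈)) x≡qⱼ

    uncovered⇒avoids-early : ∀ {k x} → k ≤ k₁ → ¬ Covered (usedBefore k) x → Avoids π q k x
    uncovered⇒avoids-early {k} k≤k₁ x∉ i 2≤i i<k x≡qᵢ =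
      x∉ (lose (subst (_∈ usedBefore k) (choice-before (<-≤-trans i<k k≤k₁)) (∈-usedBefore⁺ 2≤i i<k)) x≡qᵢ)

    q-isMinAvoid : ∀ {k} → 2 ≤ k → k ≤ n → IsMinAvoid m π q k (q k)
    q-isMinAvoid {suc (suc zero)} 2≤k k≤n =
      (proj₁ (q-range 2 2≤k k≤n) , proj₂ (q-range 2 2≤k k≤n) , λ { i (s≤s (s≤s _)) (s≤s (s≤s ())) }) , λ j 1≤j _ _ → subst (_≤ j) (sym q₂≡1) 1≤j
    q-isMinAvoid {suc zero} (s≤s ()) _
    q-isMinAvoid {suc (suc (suc k))} _ k≤n = q-minAvoid (3 + k) (s≤s (s≤s (s≤s z≤n))) k≤n

    k₁≤n : k₁ ≤ n
    k₁≤n = <⇒≤ (<-≤-trans k₁<k₂ k₂≤n)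

    r-before : ∀ {k} → 2 ≤ k → k ≤ k₁ → r k ≡ q k
    r-before {k} 2≤k k≤k₁ with q-isMinAvoid 2≤k (≤-trans k≤k₁ k₁≤n)
    ... | (1≤qₖ , qₖ≤m , qₖ-avoids) , qₖ-least with leastUncovered-spec 1≤qₖ qₖ≤m (avoids⇒uncovered-early {x = q k} k≤k₁ qₖ-avoids)
    ...   | (1≤r , r≤m , r∉) , r-least = ≤-antisym
      (r-least (q k) 1≤qₖ qₖ≤m (avoids⇒uncovered-early {x = q k} k≤k₁ qₖ-avoids))
      (qₖ-least (r k) 1≤r r≤m (uncovered⇒avoids-early {x = r k} k≤k₁ r∉))

    uncovered-exists : ∀ {k} → 2 ≤ k → k ≤ n → Unique (usedBefore k) → usedBefore k ⊆ indices n →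
                       ∃ λ x → 1 ≤ x × x ≤ m × ¬ Covered (usedBefore k) x
    uncovered-exists {k} 2≤k k≤n unique ⊆indices
      with anyUpTo? (uncovered? (usedBefore k)) (suc m)
    ... | yes (x , x<1+m , 1≤x , x∉) = x , 1≤x , ≤-pred x<1+m , x∉
    ... | no ∄ = contradiction
      (unique⊆⇒length≤ (indices-unique n) (covering⇒complete ω perm ⊆indices covering))
      (subst₂ (λ a b → ¬ a ≤ b) (sym (length-indices n)) (sym (length-usedBefore k)) (<⇒≱ (k∸2<n∸1 2≤k k≤n)))
      where
      covering : ∀ x → 1 ≤ x → x ≤ m → Covered (usedBefore k) x
      covering x 1≤x x≤m = decidable-stable (covered? _ x) λ x∉ → ∄ (x , s≤s x≤m , 1≤x , x∉)

    chosen-fresh : ∀ {k} → 2 ≤ k → k ≤ n → Unique (usedBefore k) → usedBefore k ⊆ indices n →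
                   chosen k ∈ indices n × chosen k ∉ usedBefore k × Cong (r k) (q (chosen k)) (ϱ k)
    chosen-fresh {k} 2≤k k≤n unique ⊆indices with <-cmp k k₁
    ... | tri< k<k₁ _ _ =
      ∈-indices⁺ 2≤k k≤n ,
      (λ k∈ → <-irrefl refl (proj₂ (∈-usedBefore-early (<⇒≤ k<k₁) k∈))) ,
      subst (λ x → Cong x (q k) (π k)) (sym (r-before 2≤k (<⇒≤ k<k₁))) (Cong-refl (q k))
    ... | tri≈ _ refl _ =
      ∈-indices⁺ (≤-trans 2≤k (<⇒≤ k₁<k₂)) k₂≤n ,
      (λ k₂∈ → <-asym k₁<k₂ (proj₂ (∈-usedBefore-early ≤-refl k₂∈))) ,
      subst (λ x → Cong x (q k₂) (π k₂)) (sym (r-before 2≤k ≤-refl)) q₁≡q₂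
    ... | tri> _ _ k₁<k with uncovered-exists 2≤k k≤n unique ⊆indices
    ...   | x , 1≤x , x≤m , x∉ with leastUncovered-spec 1≤x x≤m x∉
    ...     | (1≤r , r≤m , r∉) , _ with q-covers (r k) 1≤r r≤m
    ...       | j , 2≤j , j≤n , r≡qⱼ with pick-spec (λ j → (j ∉? usedBefore k) ×-dec Cong? (r k) (q j) (π j)) {d = 0}
                                        (lose (∈-indices⁺ 2≤j j≤n) ((λ j∈ → r∉ (lose j∈ r≡qⱼ)) , r≡qⱼ))
    ...         | pick∈ , pick∉ , r≡q-pick = pick∈ , pick∉ , r≡q-pick

    usedBefore-valid : ∀ k → k ≤ suc n → Unique (usedBefore k) × usedBefore k ⊆ indices n
    usedBefore-valid zero                _ = [] , λ ()
    usedBefore-valid (suc zero)          _ = [] , λ ()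
    usedBefore-valid (suc (suc zero))    _ = [] , λ ()
    usedBefore-valid (suc (suc (suc k))) (s≤s 2+k≤n) with usedBefore-valid (suc (suc k)) (m≤n⇒m≤1+n 2+k≤n)
    ... | unique , ⊆indices with chosen-fresh (s≤s (s≤s z≤n)) 2+k≤n unique ⊆indices
    ...   | chosen∈ , chosen∉ , _ =
      (All.¬Any⇒All¬ _ chosen∉ ∷ unique) , λ { (here refl) → chosen∈ ; (there j∈) → ⊆indices j∈ }

    chosen-spec : ∀ {k} → 2 ≤ k → k ≤ n →
                  chosen k ∈ indices n × chosen k ∉ usedBefore k × Cong (r k) (q (chosen k)) (ϱ k)
    chosen-spec {k} 2≤k k≤n =
      let (unique , ⊆indices) = usedBefore-valid k (m≤n⇒m≤1+n k≤n) in chosen-fresh 2≤k k≤n unique ⊆indices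

    r-least : ∀ {k} → 2 ≤ k → k ≤ n → IsLeastUncovered (usedBefore k) (r k)
    r-least {k} 2≤k k≤n =
      let (unique , ⊆indices) = usedBefore-valid k (m≤n⇒m≤1+n k≤n)
          (x , 1≤x , x≤m , x∉) = uncovered-exists 2≤k k≤n unique ⊆indices
      in leastUncovered-spec 1≤x x≤m x∉

    r≡q∘chosen : ∀ {k} → 2 ≤ k → k ≤ n → Cong (r k) (q (chosen k)) (ϱ k)
    r≡q∘chosen 2≤k k≤n = proj₂ (proj₂ (chosen-spec 2≤k k≤n))

    chosen-range : ∀ {k} → 2 ≤ k → k ≤ n → 2 ≤ chosen k × chosen k ≤ n
    chosen-range 2≤k k≤n = ∈-indices⁻ (proj₁ (chosen-spec 2≤k k≤n))

    chosen-injective : ∀ {i j} → 2 ≤ i → i ≤ n → 2 ≤ j → j ≤ n → chosen i ≡ chosen j → i ≡ j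
    chosen-injective {i} {j} 2≤i i≤n 2≤j j≤n chosenᵢ≡chosenⱼ with <-cmp i j
    ... | tri< i<j _ _ = contradiction (subst (_∈ usedBefore j) chosenᵢ≡chosenⱼ (∈-usedBefore⁺ 2≤i i<j))
                                       (proj₁ (proj₂ (chosen-spec 2≤j j≤n)))
    ... | tri≈ _ i≡j _ = i≡j
    ... | tri> _ _ j<i = contradiction (subst (_∈ usedBefore i) (sym chosenᵢ≡chosenⱼ) (∈-usedBefore⁺ 2≤j j<i))
                                       (proj₁ (proj₂ (chosen-spec 2≤i i≤n)))

    -- n - 1 distinct indices have been placed, so each of the n - 1 indices was placed somewhere.
    chosen-onto : ∀ {j} → j ∈ indices n → ∃ λ k → 2 ≤ k × k ≤ n × chosen k ≡ j
    chosen-onto {j} j∈indices with j ∈? usedBefore (suc n) | usedBefore-valid (suc n) ≤-refl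
    ... | yes j∈ | _ with ∈-usedBefore⁻ j∈
    ...   | k , 2≤k , s≤s k≤n , chosenₖ≡j = k , 2≤k , k≤n , chosenₖ≡j
    chosen-onto {j} j∈indices | no j∉ | unique , ⊆indices = contradiction (begin-strict
      length (indices n)                     ≡⟨ trans (length-indices n) (sym (length-usedBefore (suc n))) ⟩
      length (usedBefore (suc n))            ≤⟨ unique⊆⇒length≤ unique (λ i∈ → ∈-filter⁺ (≢j?) (⊆indices i∈) λ { refl → j∉ i∈ }) ⟩
      length (filter (≢j?) (indices n))      <⟨ filter-notAll (≢j?) (indices n) (lose j∈indices λ j≢j → j≢j refl) ⟩
      length (indices n)                     ∎) (n≮n _)
      where
      open ≤-Reasoning
      ≢j? : Decidable (_≢ j)
      ≢j? i = ¬? (i ≟ j)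

    uncovered⇒avoids : ∀ {k x} → k ≤ n → ¬ Covered (usedBefore k) x → Avoids ϱ r k x
    uncovered⇒avoids {k} {x} k≤n x∉ i 2≤i i<k x≡rᵢ =
      x∉ (covered⁺ {k = k} {x} 2≤i i<k (Cong-trans x (r i) (q (chosen i)) x≡rᵢ (r≡q∘chosen 2≤i (<⇒≤ (<-≤-trans i<k k≤n)))))

    avoids⇒uncovered : ∀ {k x} → k ≤ n → Avoids ϱ r k x → ¬ Covered (usedBefore k) x
    avoids⇒uncovered {k} {x} k≤n avoids x∈ with covered⁻ {k} {x} x∈
    ... | i , 2≤i , i<k , x≡qᵢ = avoids i 2≤i i<k
      (Cong-trans x (q (chosen i)) (r i) x≡qᵢ (Cong-sym (r i) (q (chosen i)) (r≡q∘chosen 2≤i (<⇒≤ (<-≤-trans i<k k≤n)))))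

    π-injective : ∀ i i′ → 2 ≤ i → i ≤ n → 2 ≤ i′ → i′ ≤ n → π i ≡ π i′ → i ≡ i′
    π-injective = proj₁ (proj₂ perm)

    ϱ-isPermPrimes : IsPermPrimes n ϱ
    ϱ-isPermPrimes = onto , injective , surjective
      where
      onto : ∀ i → 2 ≤ i → i ≤ n → ∃ λ j → 2 ≤ j × j ≤ n × ϱ i ≡ p j
      onto i 2≤i i≤n = let (2≤c , c≤n) = chosen-range 2≤i i≤n in proj₁ perm (chosen i) 2≤c c≤n
      injective : ∀ i i′ → 2 ≤ i → i ≤ n → 2 ≤ i′ → i′ ≤ n → ϱ i ≡ ϱ i′ → i ≡ i′
      injective i i′ 2≤i i≤n 2≤i′ i′≤n ϱᵢ≡ϱᵢ′ =
        let (2≤c , c≤n) = chosen-range 2≤i i≤n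
            (2≤c′ , c′≤n) = chosen-range 2≤i′ i′≤n
        in chosen-injective 2≤i i≤n 2≤i′ i′≤n (π-injective (chosen i) (chosen i′) 2≤c c≤n 2≤c′ c′≤n ϱᵢ≡ϱᵢ′)
      surjective : ∀ j → 2 ≤ j → j ≤ n → ∃ λ i → 2 ≤ i × i ≤ n × ϱ i ≡ p j
      surjective j 2≤j j≤n with proj₂ (proj₂ perm) j 2≤j j≤n
      ... | i , 2≤i , i≤n , πᵢ≡pⱼ with chosen-onto (∈-indices⁺ 2≤i i≤n)
      ...   | k , 2≤k , k≤n , refl = k , 2≤k , k≤n , πᵢ≡pⱼ

    r-range : ∀ i → 2 ≤ i → i ≤ n → 1 ≤ r i × r i ≤ m
    r-range i 2≤i i≤n = let ((1≤r , r≤m , _) , _) = r-least 2≤i i≤n in 1≤r , r≤m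

    r-nonzero : ∀ i → 2 ≤ i → i ≤ n → ¬ Cong (r i) 0 (ϱ i)
    r-nonzero i 2≤i i≤n rᵢ≡0 = let (2≤c , c≤n) = chosen-range 2≤i i≤n in
      q-nonzero (chosen i) 2≤c c≤n (Cong-trans (q (chosen i)) (r i) 0 (Cong-sym (r i) (q (chosen i)) (r≡q∘chosen 2≤i i≤n)) rᵢ≡0)

    r-increasing : ∀ i j → 2 ≤ i → i < j → j ≤ n → r i < r j
    r-increasing i j 2≤i i<j j≤n = ≤∧≢⇒< rᵢ≤rⱼ rᵢ≢rⱼ
      where
      rᵢ-least : IsLeastUncovered (usedBefore i) (r i)
      rᵢ-least = r-least 2≤i (<⇒≤ (<-≤-trans i<j j≤n))
      rⱼ-least : IsLeastUncovered (usedBefore j) (r j)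
      rⱼ-least = r-least (≤-trans 2≤i (<⇒≤ i<j)) j≤n
      rⱼ∉ : ¬ Covered (usedBefore j) (r j)
      rⱼ∉ = proj₂ (proj₂ (proj₁ rⱼ-least))
      rᵢ≤rⱼ : r i ≤ r j
      rᵢ≤rⱼ = proj₂ rᵢ-least (r j) (proj₁ (proj₁ rⱼ-least)) (proj₁ (proj₂ (proj₁ rⱼ-least))) λ rⱼ∈ →
        let (i′ , 2≤i′ , i′<i , rⱼ≡) = covered⁻ {i} {r j} rⱼ∈ in rⱼ∉ (covered⁺ {k = j} {r j} 2≤i′ (<-trans i′<i i<j) rⱼ≡)
      rᵢ≢rⱼ : r i ≢ r j
      rᵢ≢rⱼ rᵢ≡rⱼ = rⱼ∉ (covered⁺ {k = j} {r j} 2≤i i<j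
        (subst (λ x → Cong x (q (chosen i)) (ϱ i)) rᵢ≡rⱼ (r≡q∘chosen 2≤i (<⇒≤ (<-≤-trans i<j j≤n)))))

    r-isMinAvoid : ∀ i → 3 ≤ i → i ≤ n → IsMinAvoid m ϱ r i (r i)
    r-isMinAvoid i 3≤i i≤n = let ((1≤r , r≤m , r∉) , least) = r-least (<⇒≤ 3≤i) i≤n in
      (1≤r , r≤m , uncovered⇒avoids {i} {r i} i≤n r∉) ,
      λ x 1≤x x≤m avoids → least x 1≤x x≤m (avoids⇒uncovered {i} {x} i≤n avoids)

    r-covers : ∀ x → 1 ≤ x → x ≤ m → ∃ λ i → 2 ≤ i × i ≤ n × Cong x (r i) (ϱ i)
    r-covers x 1≤x x≤m with q-covers x 1≤x x≤m
    ... | j , 2≤j , j≤n , x≡qⱼ with chosen-onto (∈-indices⁺ 2≤j j≤n)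
    ...   | k , 2≤k , k≤n , refl = k , 2≤k , k≤n , Cong-trans x (q j) (r k) x≡qⱼ (Cong-sym (r k) (q j) (r≡q∘chosen 2≤k k≤n))

    admissible : Admissible n m ϱ r
    admissible = ϱ-isPermPrimes , r-range , r-nonzero , r-increasing , trans (r-before ≤-refl 2≤k₁) q₂≡1 , r-isMinAvoid , r-covers

    agree-before : ∀ k → 2 ≤ k → k < k₁ → ϱ k ≡ π k × r k ≡ q k
    agree-before k 2≤k k<k₁ = cong π (choice-before k<k₁) , r-before 2≤k (<⇒≤ k<k₁)

    residue-preserved : ∀ k → 2 ≤ k → k ≤ n → ∀ j → 2 ≤ j → j ≤ n → ϱ k ≡ π j → Cong (r k) (q j) (ϱ k)
    residue-preserved k 2≤k k≤n j 2≤j j≤n ϱₖ≡πⱼ = let (2≤c , c≤n) = chosen-range 2≤k k≤n in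
      subst (λ i → Cong (r k) (q i) (ϱ k)) (π-injective (chosen k) j 2≤c c≤n 2≤j j≤n ϱₖ≡πⱼ) (r≡q∘chosen 2≤k k≤n)

proposition2p1 : (n m : ℕ) → 1 < n → IsOmega n m →
    (π q : ℕ → ℕ) → Admissible n m π q →
    (k₁ k₂ : ℕ) → 2 ≤ k₁ → k₁ < k₂ → k₂ ≤ n → Cong (q k₁) (q k₂) (π k₂) →
    ∃ λ ϱ → ∃ λ r → Admissible n m ϱ r ×
    (∀ k → 2 ≤ k → k < k₁ → ϱ k ≡ π k × r k ≡ q k) ×
    ϱ k₁ ≡ π k₂ × r k₁ ≡ q k₁ ×
    (∀ k → k₁ < k → k ≤ n → ∀ j → 2 ≤ j → j ≤ n → ϱ k ≡ π j → Cong (r k) (q j) (ϱ k))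
proposition2p1 n m _ ω π q (perm , q-range , q-nonzero , _ , q₂≡1 , q-minAvoid , q-covers) k₁ k₂ 2≤k₁ k₁<k₂ k₂≤n q₁≡q₂ =
  ϱ , r , admissible , agree-before , cong π choice-at , r-before 2≤k₁ ≤-refl ,
  λ k k₁<k → residue-preserved k (≤-trans 2≤k₁ (<⇒≤ k₁<k))
  where
  open Exchange n m π q k₁ k₂
  open Properties ω perm q-range q-nonzero q₂≡1 q-minAvoid q-covers 2≤k₁ k₁<k₂ k₂≤n q₁≡q₂
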